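{- Let $a\ge2$, $\ell\ge1$, $n=a+\ell-1$, $\mu=(a,1^{\ell-1})$, $\rho=(a-1,1^\ell)$. Let $SF_>(\mu)=\{S\in SF(\mu): S_{1,1}>S_{1,a}\}$ and $SF_>(\rho)=\{T\in SF(\rho): T_{\ell+1,1}>T_{1,1}\}$. Then (1) for every $S\in SF_>(\mu)$ and every $T\in SF(\rho)$, $\varphi_S\neq\varphi_T$; and (2) for every $T\in SF_>(\rho)$ and every $S\in SF(\mu)$, $\varphi_T\neq\varphi_S$.
   Context: Fillings use French convention (row $1$ is the bottom row); $S_{i,j}$ is the entry in row $i$, column $j$. For a hook $\nu\vdash n$, $SF(\nu)$ is the set of standard fillings (bijections from the cells of $\nu$ to $\{1,\dots,n\}$). A row inversion of $S$ is a pair $(t,r)$ of entries of row $1$ with $t$ left of $r$ and $t>r$; a column inversion is a pair $(d,c)$ of entries of column $1$ with $d$ above $c$ and $d>c$. Define the monomial $\varphi_S=\prod_{(d,c)\text{ col. inv.}}x_d\prod_{(t,r)\text{ row inv.}}y_r\in\mathbb{Q}[x_1,\dots,x_n,y_1,\dots,y_n]$. -}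

module Defs where

open import Data.Nat using (ℕ; zero; suc; _+_)
open import Data.Fin using (Fin; zero; suc; _<_; _<?_; fromℕ)
open import Data.Fin.Properties using (_≟_)
open import Data.Sum using (_⊎_; inj₁; inj₂)
open import Data.Product using (Σ; _×_)
open import Data.Bool using (Bool; if_then_else_; _∧_)
open import Data.List using (List; map; allFin)
open import Data.Nat.ListAction using (sum)
open import Data.Vec using (Vec; tabulate)
open import Relation.Nullary.Decidable using (⌊_⌋)
open import Relation.Binary.PropositionalEquality using (_≡_)
open import Function.Definitions using (Bijective)

-- Cells of the hook with row 1 of length (suc r) and column 1 of height (suc h),
-- i.e. the hook (suc r , 1^h), which has suc r + h cells (French convention).
--   inj₁ j  is the cell in row 1,        column (j+1)   (j = 0 .. r)
--   inj₂ i  is the cell in row (i+2),    column 1       (i = 0 .. h-1)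
Cell : ℕ → ℕ → Set
Cell r h = Fin (suc r) ⊎ Fin h

-- A standard filling of that hook with values in {1..n} (encoded as Fin n,
-- value k+1 encoded as k): a bijection from the cells onto Fin n.
SF : (n r h : ℕ) → Set
SF n r h = Σ (Cell r h → Fin n) (λ f → Bijective _≡_ _≡_ f)

module _ {n r h : ℕ} (S : SF n r h) where
  private
    f : Cell r h → Fin n
    f = Σ.proj₁ S

  rowEntry : Fin (suc r) → Fin n
  rowEntry j = f (inj₁ j)

  colEntry : Fin (suc h) → Fin n
  colEntry zero    = f (inj₁ zero)
  colEntry (suc i) = f (inj₂ i)

  private
    countPairs : (m : ℕ) → (Fin m → Fin m → Bool) → ℕ
    countPairs m P = sum (map (λ p → sum (map (λ q → if P p q then 1 else 0) (allFin m))) (allFin m))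

  -- exponent of x_k in φ_S: number of column inversions (d , c) with d = k,
  -- i.e. rows i < i' of column 1 with entry(i') > entry(i) and entry(i') = k
  xExp : Fin n → ℕ
  xExp k = countPairs (suc h) (λ i i' →
    ⌊ i <? i' ⌋ ∧ ⌊ colEntry i <? colEntry i' ⌋ ∧ ⌊ colEntry i' ≟ k ⌋)

  -- exponent of y_k in φ_S: number of row inversions (t , r) with r = k,
  -- i.e. columns j < j' of row 1 with entry(j) > entry(j') and entry(j') = k
  yExp : Fin n → ℕ
  yExp k = countPairs (suc r) (λ j j' →
    ⌊ j <? j' ⌋ ∧ ⌊ rowEntry j' <? rowEntry j ⌋ ∧ ⌊ rowEntry j' ≟ k ⌋)

  -- the monomial φ_S, represented by its exponent vectors (x-exponents , y-exponents)
  φ : Vec ℕ n × Vec ℕ n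
  φ = tabulate xExp Data.Product., tabulate yExp

{-# OPTIONS --safe #-}
-- Read a hook filling as an arm (row 1, ordered by <) and a leg (column 1, ordered by >) meeting
-- at the corner c.  The y-exponent of a value counts the larger arm entries to its left and the
-- x-exponent counts the smaller leg entries below it.  So an arm value v ≠ c has x-exponent 0, and
-- positive y-exponent if v < c; symmetrically for the leg.  Hence φ and c determine the arm: it
-- consists of c, the values above c with x-exponent 0, and the values below c with positive
-- y-exponent.  Raising c can only remove values from this set, and it removes the old corner.
-- Now let φ_S = φ_T, where S has the longer arm and its last arm entry t is below its corner.
-- Equal corners would give arms of equal length, and c_T < c_S would make the arm of T strictly
-- longer.  If c_S < c_T, then T has strictly fewer arm values above t than S; but the y-exponent of
-- t is the number of arm values of S above t and at most the number of those of T.  Part (2) is the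
-- same argument with rows and columns exchanged and the order reversed.
module Submission where

open import Defs
open import Data.Nat using (ℕ; suc; _+_)
open import Data.Fin using (Fin; zero; _<_; fromℕ)
open import Data.Product using (_×_)
open import Relation.Binary.PropositionalEquality using (_≢_)

open import Level using (0ℓ)
open import Data.Bool using (Bool; true; false; if_then_else_; _∧_)
open import Data.Bool.Properties using (∧-assoc)
open import Data.Empty using (⊥)
open import Data.Fin using (suc; _<?_)
open import Data.Fin.Properties
  using (_≟_; any?; 0≢1+n; suc-injective; <-isStrictTotalOrder; ≤fromℕ; ≤∧≢⇒<)
open import Data.List using (allFin) renaming (map to mapList; tabulate to tabulateList)
open import Data.List.Properties using (map-tabulate)
open import Data.Nat using (_≤_; z≤n; s≤s; _<ᵇ_; _≡ᵇ_) renaming (_<_ to _<ℕ_)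
open import Data.Nat.ListAction using () renaming (sum to sumList)
open import Data.Nat.Properties
  using ( +-0-commutativeMonoid; +-mono-≤; +-mono-<-≤; +-mono-≤-<; +-identityʳ
        ; ≤-refl; ≤-reflexive; ≤-trans; <-≤-trans; m≤m+n; m≤n+m; <-irrefl; <-asym; >⇒≢; n<1+n
        ; module ≤-Reasoning)
open import Data.Product using (_,_; proj₁; proj₂; ∃)
open import Data.Sum using (_⊎_; inj₁; inj₂)
open import Data.Unit using (tt)
open import Data.Sum.Properties using (inj₁-injective; inj₂-injective)
open import Data.Vec using (tabulate; lookup)
open import Data.Vec.Properties using (lookup∘tabulate)
open import Function using (_∘_; _∋_; flip; id)
open import Function.Definitions using (Injective)
open import Relation.Binary using (Rel; Decidable; Irreflexive; IsStrictTotalOrder; Tri; tri<; tri≈; tri>)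
import Relation.Binary.Construct.Flip.EqAndOrd as Flip
open import Relation.Binary.PropositionalEquality
  using (_≡_; refl; sym; trans; cong; subst; _≗_; module ≡-Reasoning)
open import Relation.Nullary using (Dec; yes; no; ¬_; contradiction)
open import Relation.Nullary.Decidable using (⌊_⌋)
open import Relation.Unary using (Pred) renaming (Decidable to Decidable₁)
open import Relation.Unary.Properties using (U?)
open import Algebra.Properties.CommutativeMonoid.Sum +-0-commutativeMonoid
  using (sum; sum-syntax; ∑-comm; sum-cong-≗; sum-replicate-zero)

𝟙 : Bool → ℕ
𝟙 b = if b then 1 else 0

𝟙≤1 : ∀ b → 𝟙 b ≤ 1
𝟙≤1 true  = ≤-refl
𝟙≤1 false = z≤n

𝟙-∧ : ∀ a c → 𝟙 (a ∧ c) ≡ (if c then 𝟙 a else 0)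
𝟙-∧ true  c     = refl
𝟙-∧ false true  = refl
𝟙-∧ false false = refl

𝟙-∧-≤ : ∀ a b → 𝟙 (a ∧ b) ≤ 𝟙 b
𝟙-∧-≤ true  b = ≤-refl
𝟙-∧-≤ false b = z≤n

𝟙-positive-≤ : ∀ x {y} → (0 <ℕ x → y ≡ 0) → 𝟙 (0 <ᵇ x) ≤ 𝟙 (y ≡ᵇ 0)
𝟙-positive-≤ 0       _ = z≤n
𝟙-positive-≤ (suc x) x>0⇒y≡0 rewrite x>0⇒y≡0 (s≤s z≤n) = ≤-refl

if-yes : ∀ {a p} {A : Set a} {P : Set p} (P? : Dec P) {x y : A} → P → (if ⌊ P? ⌋ then x else y) ≡ x
if-yes (yes _) _ = refl
if-yes (no ¬p) p = contradiction p ¬p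

if-no : ∀ {a p} {A : Set a} {P : Set p} (P? : Dec P) {x y : A} → ¬ P → (if ⌊ P? ⌋ then x else y) ≡ y
if-no (yes p) ¬p = contradiction p ¬p
if-no (no _)  _  = refl

if-0 : ∀ b → (if b then 0 else 0) ≡ 0
if-0 true  = refl
if-0 false = refl

if-mono-≤ : ∀ b {x y} → x ≤ y → (if b then x else 0) ≤ (if b then y else 0)
if-mono-≤ true  x≤y = x≤y
if-mono-≤ false _   = z≤n

sumList-allFin : ∀ m (f : Fin m → ℕ) → sumList (mapList f (allFin m)) ≡ ∑[ i < m ] f i
sumList-allFin m f = trans (cong sumList (map-tabulate id f)) (sumList-tabulate m f)
  where
  sumList-tabulate : ∀ k (g : Fin k → ℕ) → sumList (tabulateList g) ≡ ∑[ i < k ] g i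
  sumList-tabulate 0       g = refl
  sumList-tabulate (suc k) g = cong (g zero +_) (sumList-tabulate k (g ∘ suc))

sumList-allFin² : ∀ m (f : Fin m → Fin m → ℕ) →
  sumList (mapList (λ i → sumList (mapList (f i) (allFin m))) (allFin m)) ≡ ∑[ i < m ] ∑[ j < m ] f i j
sumList-allFin² m f = trans (sumList-allFin m _) (sum-cong-≗ (λ i → sumList-allFin m (f i)))

∑-mono-≤ : ∀ {m} {f g : Fin m → ℕ} → (∀ i → f i ≤ g i) → ∑[ i < m ] f i ≤ ∑[ i < m ] g i
∑-mono-≤ {0}     _   = z≤n
∑-mono-≤ {suc m} f≤g = +-mono-≤ (f≤g zero) (∑-mono-≤ (f≤g ∘ suc))

∑-mono-< : ∀ {m} {f g : Fin m → ℕ} → (∀ i → f i ≤ g i) → ∀ i → f i <ℕ g i → ∑[ i < m ] f i <ℕ ∑[ i < m ] g i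
∑-mono-< f≤g zero    fi<gi = +-mono-<-≤ fi<gi (∑-mono-≤ (f≤g ∘ suc))
∑-mono-< f≤g (suc i) fi<gi = +-mono-≤-< (f≤g zero) (∑-mono-< (f≤g ∘ suc) i fi<gi)

∑-zero : ∀ {m} {f : Fin m → ℕ} → (∀ i → f i ≡ 0) → ∑[ i < m ] f i ≡ 0
∑-zero {m} f≡0 = trans (sum-cong-≗ f≡0) (sum-replicate-zero m)

∑-single : ∀ {m} (f : Fin m → ℕ) u → (∀ v → v ≢ u → f v ≡ 0) → ∑[ i < m ] f i ≡ f u
∑-single f zero    off = trans (cong (f zero +_) (∑-zero (λ v → off (suc v) λ ()))) (+-identityʳ (f zero))
∑-single f (suc u) off =
  trans (cong (_+ sum (f ∘ suc)) (off zero 0≢1+n))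
        (∑-single (f ∘ suc) u (λ v v≢u → off (suc v) (v≢u ∘ suc-injective)))

term≤∑ : ∀ {m} (f : Fin m → ℕ) i → f i ≤ ∑[ i < m ] f i
term≤∑ f zero    = m≤m+n (f zero) _
term≤∑ f (suc i) = ≤-trans (term≤∑ (f ∘ suc) i) (m≤n+m _ (f zero))

∑-if : ∀ {m} b (f : Fin m → ℕ) → ∑[ i < m ] (if b then f i else 0) ≡ (if b then ∑[ i < m ] f i else 0)
∑-if     true  f = refl
∑-if {m} false f = ∑-zero {m} (λ _ → refl)

∑-ones : ∀ m → ∑[ i < m ] 1 ≡ m
∑-ones 0       = refl
∑-ones (suc m) = cong suc (∑-ones m)

multiplicity : ∀ {m n} → (Fin m → Fin n) → Fin n → ℕ
multiplicity {m} e v = ∑[ p < m ] 𝟙 ⌊ e p ≟ v ⌋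

multiplicity-image : ∀ {m n} {e : Fin m → Fin n} → Injective _≡_ _≡_ e → ∀ p → multiplicity e (e p) ≡ 1
multiplicity-image {e = e} e-injective p =
  trans (∑-single _ p (λ q q≢p → if-no (e q ≟ e p) (q≢p ∘ e-injective))) (if-yes (e p ≟ e p) refl)

multiplicity-∉ : ∀ {m n} {e : Fin m → Fin n} {v} → (∀ p → e p ≢ v) → multiplicity e v ≡ 0
multiplicity-∉ {e = e} {v} v∉e = ∑-zero (λ p → if-no (e p ≟ v) (v∉e p))

∑-via-multiplicity : ∀ {m n} (e : Fin m → Fin n) (Q : Fin n → Bool) →
  ∑[ p < m ] 𝟙 (Q (e p)) ≡ ∑[ v < n ] (if Q v then multiplicity e v else 0)
∑-via-multiplicity {m} {n} e Q = begin
  ∑[ p < m ] 𝟙 (Q (e p))                                      ≡⟨ sum-cong-≗ (λ p → 𝟙-as-sum (e p)) ⟩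
  ∑[ p < m ] ∑[ v < n ] (if Q v then 𝟙 ⌊ e p ≟ v ⌋ else 0)  ≡⟨ ∑-comm {m} {n} (λ p v → if Q v then 𝟙 ⌊ e p ≟ v ⌋ else 0) ⟩
  ∑[ v < n ] ∑[ p < m ] (if Q v then 𝟙 ⌊ e p ≟ v ⌋ else 0)  ≡⟨ sum-cong-≗ (λ v → ∑-if (Q v) (λ p → 𝟙 ⌊ e p ≟ v ⌋)) ⟩
  ∑[ v < n ] (if Q v then multiplicity e v else 0)            ∎
  where
  open ≡-Reasoning
  𝟙-as-sum : ∀ u → 𝟙 (Q u) ≡ ∑[ v < n ] (if Q v then 𝟙 ⌊ u ≟ v ⌋ else 0)
  𝟙-as-sum u = sym (trans (∑-single _ u off) (cong (λ x → if Q u then x else 0) (if-yes (u ≟ u) refl)))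
    where
    off : ∀ v → v ≢ u → (if Q v then 𝟙 ⌊ u ≟ v ⌋ else 0) ≡ 0
    off v v≢u = trans (cong (λ x → if Q v then x else 0) (if-no (u ≟ v) (v≢u ∘ sym))) (if-0 (Q v))

module Inversions {n ℓ} {_≺_ : Rel (Fin n) ℓ} (≺-irrefl : Irreflexive _≡_ _≺_) (_≺?_ : Decidable _≺_) where

  inversionsEndingAt : ∀ {m} → (Fin m → Fin n) → Fin m → ℕ
  inversionsEndingAt {m} e q = ∑[ p < m ] 𝟙 (⌊ p <? q ⌋ ∧ ⌊ e q ≺? e p ⌋)

  inversionsAt : ∀ {m} → (Fin m → Fin n) → Fin n → ℕ
  inversionsAt {m} e k = ∑[ p < m ] ∑[ q < m ] 𝟙 (⌊ p <? q ⌋ ∧ ⌊ e q ≺? e p ⌋ ∧ ⌊ e q ≟ k ⌋)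

  inversionsAt-byEnd : ∀ {m} (e : Fin m → Fin n) k →
    inversionsAt e k ≡ ∑[ q < m ] (if ⌊ e q ≟ k ⌋ then inversionsEndingAt e q else 0)
  inversionsAt-byEnd {m} e k = begin
    ∑[ p < m ] ∑[ q < m ] 𝟙 (⌊ p <? q ⌋ ∧ ⌊ e q ≺? e p ⌋ ∧ ⌊ e q ≟ k ⌋)
      ≡⟨ sum-cong-≗ (λ p → sum-cong-≗ (λ q → 𝟙-∧∧ ⌊ p <? q ⌋ ⌊ e q ≺? e p ⌋ ⌊ e q ≟ k ⌋)) ⟩
    ∑[ p < m ] ∑[ q < m ] (if ⌊ e q ≟ k ⌋ then 𝟙 (⌊ p <? q ⌋ ∧ ⌊ e q ≺? e p ⌋) else 0)
      ≡⟨ ∑-comm {m} {m} (λ p q → if ⌊ e q ≟ k ⌋ then 𝟙 (⌊ p <? q ⌋ ∧ ⌊ e q ≺? e p ⌋) else 0) ⟩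
    ∑[ q < m ] ∑[ p < m ] (if ⌊ e q ≟ k ⌋ then 𝟙 (⌊ p <? q ⌋ ∧ ⌊ e q ≺? e p ⌋) else 0)
      ≡⟨ sum-cong-≗ (λ q → ∑-if ⌊ e q ≟ k ⌋ (λ p → 𝟙 (⌊ p <? q ⌋ ∧ ⌊ e q ≺? e p ⌋))) ⟩
    ∑[ q < m ] (if ⌊ e q ≟ k ⌋ then inversionsEndingAt e q else 0) ∎
    where
    open ≡-Reasoning
    𝟙-∧∧ : ∀ a b c → 𝟙 (a ∧ b ∧ c) ≡ (if c then 𝟙 (a ∧ b) else 0)
    𝟙-∧∧ a b c = trans (cong 𝟙 (sym (∧-assoc a b c))) (𝟙-∧ (a ∧ b) c)

  inversionsAt-∉ : ∀ {m} (e : Fin m → Fin n) {k} → (∀ q → e q ≢ k) → inversionsAt e k ≡ 0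
  inversionsAt-∉ e {k} k∉e = trans (inversionsAt-byEnd e k) (∑-zero (λ q → if-no (e q ≟ k) (k∉e q)))

  inversionsAt-image : ∀ {m} {e : Fin m → Fin n} → Injective _≡_ _≡_ e →
    ∀ q → inversionsAt e (e q) ≡ inversionsEndingAt e q
  inversionsAt-image {e = e} e-injective q =
    trans (inversionsAt-byEnd e (e q))
      (trans (∑-single _ q (λ p p≢q → if-no (e p ≟ e q) (p≢q ∘ e-injective))) (if-yes (e q ≟ e q) refl))

  inversionsEndingAt-zero : ∀ {m} (e : Fin (suc m) → Fin n) → inversionsEndingAt e zero ≡ 0
  inversionsEndingAt-zero {m} e = ∑-zero {suc m} (λ p → refl)

  inversionsEndingAt-pos : ∀ {m} (e : Fin (suc m) → Fin n) q → e q ≺ e zero → 0 <ℕ inversionsEndingAt e q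
  inversionsEndingAt-pos e zero    e₀≺e₀ = contradiction e₀≺e₀ (≺-irrefl refl)
  inversionsEndingAt-pos e (suc q) eq≺e₀ =
    <-≤-trans (≤-reflexive (sym (if-yes (e (suc q) ≺? e zero) eq≺e₀))) (term≤∑ (λ p → 𝟙 (⌊ p <? suc q ⌋ ∧ ⌊ e (suc q) ≺? e p ⌋)) zero)

  inversionsEndingAt-≤ : ∀ {m} (e : Fin m → Fin n) q → inversionsEndingAt e q ≤ ∑[ p < m ] 𝟙 ⌊ e q ≺? e p ⌋
  inversionsEndingAt-≤ e q = ∑-mono-≤ (λ p → 𝟙-∧-≤ ⌊ p <? q ⌋ ⌊ e q ≺? e p ⌋)

  inversionsEndingAt-last : ∀ {m} (e : Fin (suc m) → Fin n) →
    inversionsEndingAt e (fromℕ m) ≡ ∑[ p < suc m ] 𝟙 ⌊ e (fromℕ m) ≺? e p ⌋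
  inversionsEndingAt-last {m} e = sum-cong-≗ earlier
    where
    earlier : ∀ p → 𝟙 (⌊ p <? fromℕ m ⌋ ∧ ⌊ e (fromℕ m) ≺? e p ⌋) ≡ 𝟙 ⌊ e (fromℕ m) ≺? e p ⌋
    earlier p with p <? fromℕ m | p ≟ fromℕ m
    ... | yes _     | _         = refl
    ... | no _      | yes refl  = sym (if-no (e (fromℕ m) ≺? e (fromℕ m)) (≺-irrefl refl))
    ... | no p≮last | no p≢last = contradiction (≤∧≢⇒< (≤fromℕ p) p≢last) p≮last

  module _ {m} {e : Fin m → Fin n} (e-injective : Injective _≡_ _≡_ e) where

    inversionsAt-≤ : ∀ k → inversionsAt e k ≤ ∑[ p < m ] 𝟙 ⌊ k ≺? e p ⌋
    inversionsAt-≤ k with any? (λ q → e q ≟ k)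
    ... | yes (q , refl) = ≤-trans (≤-reflexive (inversionsAt-image e-injective q)) (inversionsEndingAt-≤ e q)
    ... | no k∉e         = ≤-trans (≤-reflexive (inversionsAt-∉ e (λ q eq → k∉e (q , eq)))) z≤n

  module _ {m} {e : Fin (suc m) → Fin n} (e-injective : Injective _≡_ _≡_ e) where

    inversionsAt-head : inversionsAt e (e zero) ≡ 0
    inversionsAt-head = trans (inversionsAt-image e-injective zero) (inversionsEndingAt-zero e)

    inversionsAt-pos : ∀ q → e q ≺ e zero → 0 <ℕ inversionsAt e (e q)
    inversionsAt-pos q eq≺e₀ = subst (0 <ℕ_) (sym (inversionsAt-image e-injective q)) (inversionsEndingAt-pos e q eq≺e₀)

    inversionsAt-last : inversionsAt e (e (fromℕ m)) ≡ ∑[ p < suc m ] 𝟙 ⌊ e (fromℕ m) ≺? e p ⌋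
    inversionsAt-last = trans (inversionsAt-image e-injective (fromℕ m)) (inversionsEndingAt-last e)

record Hook (n r h : ℕ) : Set where
  field
    arm            : Fin (suc r) → Fin n
    leg            : Fin (suc h) → Fin n
    arm₀≡leg₀      : arm zero ≡ leg zero
    arm-injective  : Injective _≡_ _≡_ arm
    leg-injective  : Injective _≡_ _≡_ leg
    cells-disjoint : ∀ i j → arm (suc i) ≢ leg (suc j)
    arm-or-leg     : ∀ v → (∃ λ i → arm i ≡ v) ⊎ (∃ λ j → leg (suc j) ≡ v)

  arm⁺≢leg : ∀ i j → arm (suc i) ≢ leg j
  arm⁺≢leg i zero    eq = 0≢1+n (sym (arm-injective (trans eq (sym arm₀≡leg₀))))
  arm⁺≢leg i (suc j)    = cells-disjoint i j

  arm≢leg⁺ : ∀ i j → arm i ≢ leg (suc j)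
  arm≢leg⁺ zero    j eq = 0≢1+n (leg-injective (trans (sym arm₀≡leg₀) eq))
  arm≢leg⁺ (suc i) j    = cells-disjoint i j

transpose : ∀ {n r h} → Hook n r h → Hook n h r
transpose H = record
  { arm            = leg
  ; leg            = arm
  ; arm₀≡leg₀      = sym arm₀≡leg₀
  ; arm-injective  = leg-injective
  ; leg-injective  = arm-injective
  ; cells-disjoint = λ j i eq → cells-disjoint i j (sym eq)
  ; arm-or-leg     = leg-or-arm
  }
  where
  open Hook H
  leg-or-arm : ∀ v → (∃ λ j → leg j ≡ v) ⊎ (∃ λ i → arm (suc i) ≡ v)
  leg-or-arm v with arm-or-leg v
  ... | inj₁ (zero  , arm₀≡v) = inj₁ (zero , trans (sym arm₀≡leg₀) arm₀≡v)
  ... | inj₁ (suc i , armᵢ≡v) = inj₂ (i , armᵢ≡v)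
  ... | inj₂ (j     , legⱼ≡v) = inj₁ (suc j , legⱼ≡v)

fillingHook : ∀ {n r h} → SF n r h → Hook n r h
fillingHook {n} {r} {h} S@(f , f-injective , f-surjective) = record
  { arm            = rowEntry S
  ; leg            = colEntry S
  ; arm₀≡leg₀      = refl
  ; arm-injective  = inj₁-injective ∘ f-injective
  ; leg-injective  = colEntry-injective
  ; cells-disjoint = λ i j eq → inj₁≢inj₂ (f-injective eq)
  ; arm-or-leg     = cell-of
  }
  where
  inj₁≢inj₂ : ∀ {i j} → inj₁ i ≢ (Cell r h ∋ inj₂ j)
  inj₁≢inj₂ ()

  colEntry-injective : Injective _≡_ _≡_ (colEntry S)
  colEntry-injective {zero}  {zero}  _  = refl
  colEntry-injective {zero}  {suc j} eq = contradiction (f-injective eq) inj₁≢inj₂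
  colEntry-injective {suc i} {zero}  eq = contradiction (sym (f-injective eq)) inj₁≢inj₂
  colEntry-injective {suc i} {suc j} eq = cong suc (inj₂-injective (f-injective eq))

  cell-of : ∀ v → (∃ λ i → rowEntry S i ≡ v) ⊎ (∃ λ j → colEntry S (suc j) ≡ v)
  cell-of v with f-surjective v
  ... | inj₁ i , hits = inj₁ (i , hits refl)
  ... | inj₂ j , hits = inj₂ (j , hits refl)

module OrderedHooks {n} {_≺_ : Rel (Fin n) 0ℓ} (≺-isStrictTotalOrder : IsStrictTotalOrder _≡_ _≺_)
                    (_≺?_ : Decidable _≺_) where

  open IsStrictTotalOrder ≺-isStrictTotalOrder using (compare; irrefl) renaming (trans to ≺-trans; asym to ≺-asym)

  private
    module ArmInversions = Inversions irrefl _≺?_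
    module LegInversions = Inversions (λ x≡y → irrefl (sym x≡y)) (flip _≺?_)

  armIndicator : (armExp legExp : Fin n → ℕ) → Fin n → Fin n → ℕ
  armIndicator armExp legExp c v with compare v c
  ... | tri< _ _ _ = 𝟙 (0 <ᵇ armExp v)
  ... | tri≈ _ _ _ = 1
  ... | tri> _ _ _ = 𝟙 (legExp v ≡ᵇ 0)

  armCount : (armExp legExp : Fin n → ℕ) → Fin n → {P : Pred (Fin n) 0ℓ} → Decidable₁ P → ℕ
  armCount armExp legExp c P? = ∑[ v < n ] (if ⌊ P? v ⌋ then armIndicator armExp legExp c v else 0)

  armIndicator-cong : ∀ {armExp armExp' legExp legExp'} → armExp ≗ armExp' → legExp ≗ legExp' →
    ∀ c v → armIndicator armExp legExp c v ≡ armIndicator armExp' legExp' c v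
  armIndicator-cong armExp≗ legExp≗ c v with compare v c
  ... | tri< _ _ _ = cong (𝟙 ∘ (0 <ᵇ_)) (armExp≗ v)
  ... | tri≈ _ _ _ = refl
  ... | tri> _ _ _ = cong (𝟙 ∘ (_≡ᵇ 0)) (legExp≗ v)

  armCount-cong : ∀ {armExp armExp' legExp legExp'} → armExp ≗ armExp' → legExp ≗ legExp' →
    ∀ c {P} (P? : Decidable₁ P) → armCount armExp legExp c P? ≡ armCount armExp' legExp' c P?
  armCount-cong armExp≗ legExp≗ c P? =
    sum-cong-≗ (λ v → cong (λ x → if ⌊ P? v ⌋ then x else 0) (armIndicator-cong armExp≗ legExp≗ c v))

  module _ {armExp legExp : Fin n → ℕ} where

    armIndicator-corner : ∀ c → armIndicator armExp legExp c c ≡ 1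
    armIndicator-corner c with compare c c
    ... | tri< c≺c _ _ = contradiction c≺c (irrefl refl)
    ... | tri≈ _ _ _   = refl
    ... | tri> _ _ c≺c = contradiction c≺c (irrefl refl)

    armIndicator-arm : ∀ {c v} → v ≢ c → legExp v ≡ 0 → (v ≺ c → 0 <ℕ armExp v) → armIndicator armExp legExp c v ≡ 1
    armIndicator-arm {c} {v} v≢c legExp≡0 below⇒armExp>0 with compare v c
    ... | tri< v≺c _ _ = positive (below⇒armExp>0 v≺c)
      where
      positive : ∀ {x} → 0 <ℕ x → 𝟙 (0 <ᵇ x) ≡ 1
      positive (s≤s z≤n) = refl
    ... | tri≈ _ v≡c _ = contradiction v≡c v≢c
    ... | tri> _ _ _   = cong (𝟙 ∘ (_≡ᵇ 0)) legExp≡0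

    armIndicator-leg : ∀ {c v} → v ≢ c → armExp v ≡ 0 → (c ≺ v → 0 <ℕ legExp v) → armIndicator armExp legExp c v ≡ 0
    armIndicator-leg {c} {v} v≢c armExp≡0 above⇒legExp>0 with compare v c
    ... | tri< _ _ _   = cong (𝟙 ∘ (0 <ᵇ_)) armExp≡0
    ... | tri≈ _ v≡c _ = contradiction v≡c v≢c
    ... | tri> _ _ c≺v = nonzero (above⇒legExp>0 c≺v)
      where
      nonzero : ∀ {x} → 0 <ℕ x → 𝟙 (x ≡ᵇ 0) ≡ 0
      nonzero (s≤s z≤n) = refl

    armIndicator-below : ∀ {c c'} → c ≺ c' → armExp c ≡ 0 → armIndicator armExp legExp c' c ≡ 0
    armIndicator-below {c} {c'} c≺c' armExp≡0 with compare c c'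
    ... | tri< _ _ _    = cong (𝟙 ∘ (0 <ᵇ_)) armExp≡0
    ... | tri≈ _ c≡c' _ = contradiction c≺c' (irrefl c≡c')
    ... | tri> _ _ c'≺c = contradiction c≺c' (≺-asym c'≺c)

    armIndicator-antitone : ∀ {c c'} → c ≺ c' → legExp c' ≡ 0 → (∀ v → 0 <ℕ armExp v → legExp v ≡ 0) →
      ∀ v → armIndicator armExp legExp c' v ≤ armIndicator armExp legExp c v
    armIndicator-antitone {c} {c'} c≺c' legExp≡0 disjoint v with compare v c' | compare v c
    ... | tri< _ _ _   | tri< _ _ _   = ≤-refl
    ... | tri< _ _ _   | tri≈ _ _ _   = 𝟙≤1 _
    ... | tri< _ _ _   | tri> _ _ _   = 𝟙-positive-≤ (armExp v) (disjoint v)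
    ... | tri≈ _ refl _ | tri< c'≺c _ _ = contradiction c≺c' (≺-asym c'≺c)
    ... | tri≈ _ refl _ | tri≈ _ c'≡c _ = contradiction c≺c' (irrefl (sym c'≡c))
    ... | tri≈ _ refl _ | tri> _ _ _    = ≤-reflexive (sym (cong (𝟙 ∘ (_≡ᵇ 0)) legExp≡0))
    ... | tri> _ _ c'≺v | tri< v≺c _ _ = contradiction (≺-trans c≺c' c'≺v) (≺-asym v≺c)
    ... | tri> _ _ c'≺v | tri≈ _ v≡c _ = contradiction (≺-trans c≺c' c'≺v) (irrefl (sym v≡c))
    ... | tri> _ _ _    | tri> _ _ _   = ≤-refl

    armCount-< : ∀ {c c'} {P} (P? : Decidable₁ P) → c ≺ c' → armExp c ≡ 0 → legExp c' ≡ 0 →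
      (∀ v → 0 <ℕ armExp v → legExp v ≡ 0) → P c → armCount armExp legExp c' P? <ℕ armCount armExp legExp c P?
    armCount-< {c} {c'} P? c≺c' armExp≡0 legExp≡0 disjoint Pc =
      ∑-mono-< (λ v → if-mono-≤ ⌊ P? v ⌋ (armIndicator-antitone c≺c' legExp≡0 disjoint v)) c at-c
      where
      at-c : (if ⌊ P? c ⌋ then armIndicator armExp legExp c' c else 0) <ℕ (if ⌊ P? c ⌋ then armIndicator armExp legExp c c else 0)
      at-c rewrite if-yes (P? c) {armIndicator armExp legExp c' c} {0} Pc | if-yes (P? c) {armIndicator armExp legExp c c} {0} Pc
                 | armIndicator-below c≺c' armExp≡0 | armIndicator-corner c = s≤s z≤n

  module _ {r h} (H : Hook n r h) where
    open Hook H

    corner : Fin n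
    corner = arm zero

    armExponent : Fin n → ℕ
    armExponent = ArmInversions.inversionsAt arm

    legExponent : Fin n → ℕ
    legExponent = LegInversions.inversionsAt leg

    armCountAt : Fin n → {P : Pred (Fin n) 0ℓ} → Decidable₁ P → ℕ
    armCountAt = armCount armExponent legExponent

    armExponent-corner : armExponent corner ≡ 0
    armExponent-corner = ArmInversions.inversionsAt-head arm-injective

    legExponent-corner : legExponent corner ≡ 0
    legExponent-corner rewrite arm₀≡leg₀ = LegInversions.inversionsAt-head leg-injective

    armExponent-leg : ∀ j → armExponent (leg (suc j)) ≡ 0
    armExponent-leg j = ArmInversions.inversionsAt-∉ arm (λ i → arm≢leg⁺ i j)

    legExponent-arm : ∀ i → legExponent (arm (suc i)) ≡ 0
    legExponent-arm i = LegInversions.inversionsAt-∉ leg (λ j eq → arm⁺≢leg i j (sym eq))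

    armExponent>0⇒legExponent≡0 : ∀ v → 0 <ℕ armExponent v → legExponent v ≡ 0
    armExponent>0⇒legExponent≡0 v armExp>0 with arm-or-leg v
    ... | inj₁ (zero  , refl) = legExponent-corner
    ... | inj₁ (suc i , refl) = legExponent-arm i
    ... | inj₂ (j     , refl) = contradiction (armExponent-leg j) (>⇒≢ armExp>0)

    multiplicity-arm : ∀ v → multiplicity arm v ≡ armIndicator armExponent legExponent corner v
    multiplicity-arm v with arm-or-leg v
    ... | inj₁ (i , refl) = trans (multiplicity-image arm-injective i) (sym (on-arm i))
      where
      on-arm : ∀ i → armIndicator armExponent legExponent corner (arm i) ≡ 1
      on-arm zero    = armIndicator-corner corner
      on-arm (suc i) = armIndicator-arm (0≢1+n ∘ sym ∘ arm-injective) (legExponent-arm i)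
                                        (ArmInversions.inversionsAt-pos arm-injective (suc i))
    ... | inj₂ (j , refl) =
      trans (multiplicity-∉ (λ i → arm≢leg⁺ i j))
            (sym (armIndicator-leg (arm≢leg⁺ zero j ∘ sym) (armExponent-leg j)
                                   (LegInversions.inversionsAt-pos leg-injective (suc j) ∘ subst (_≺ leg (suc j)) arm₀≡leg₀)))

    armCountAt-corner : ∀ {P} (P? : Decidable₁ P) → armCountAt corner P? ≡ ∑[ p < suc r ] 𝟙 ⌊ P? (arm p) ⌋
    armCountAt-corner P? = begin
      armCountAt corner P?
        ≡⟨ sum-cong-≗ (λ v → cong (λ x → if ⌊ P? v ⌋ then x else 0) (sym (multiplicity-arm v))) ⟩
      ∑[ v < n ] (if ⌊ P? v ⌋ then multiplicity arm v else 0)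
        ≡⟨ sym (∑-via-multiplicity arm (λ v → ⌊ P? v ⌋)) ⟩
      ∑[ p < suc r ] 𝟙 ⌊ P? (arm p) ⌋ ∎
      where open ≡-Reasoning

    armLength : armCountAt corner U? ≡ suc r
    armLength = trans (armCountAt-corner U?) (∑-ones (suc r))

    armExponent-≤-armCount : ∀ t → armExponent t ≤ armCountAt corner (t ≺?_)
    armExponent-≤-armCount t = ≤-trans (ArmInversions.inversionsAt-≤ arm-injective t) (≤-reflexive (sym (armCountAt-corner (t ≺?_))))

    armExponent-armEnd : armExponent (arm (fromℕ r)) ≡ armCountAt corner (arm (fromℕ r) ≺?_)
    armExponent-armEnd = trans (ArmInversions.inversionsAt-last arm-injective) (sym (armCountAt-corner _))

  different-exponents : ∀ {r₁ h₁ r₂ h₂} (H₁ : Hook n r₁ h₁) (H₂ : Hook n r₂ h₂) → r₂ <ℕ r₁ →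
    Hook.arm H₁ (fromℕ r₁) ≺ corner H₁ → armExponent H₁ ≗ armExponent H₂ → legExponent H₁ ≗ legExponent H₂ → ⊥
  different-exponents {r₁} {_} {r₂} H₁ H₂ r₂<r₁ end≺corner armExp≗ legExp≗ = by-corners (compare (corner H₁) (corner H₂))
    where
    open ≤-Reasoning
    t = Hook.arm H₁ (fromℕ r₁)

    armCountAt-≗ : ∀ c {P} (P? : Decidable₁ P) → armCountAt H₁ c P? ≡ armCountAt H₂ c P?
    armCountAt-≗ = armCount-cong armExp≗ legExp≗

    by-corners : Tri (corner H₁ ≺ corner H₂) (corner H₁ ≡ corner H₂) (corner H₂ ≺ corner H₁) → ⊥
    by-corners (tri≈ _ c₁≡c₂ _) = <-irrefl (sym equalLengths) (s≤s r₂<r₁)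
      where
      equalLengths : suc r₁ ≡ suc r₂
      equalLengths = begin-equality
        suc r₁                       ≡⟨ armLength H₁ ⟨
        armCountAt H₁ (corner H₁) U? ≡⟨ cong (λ c → armCountAt H₁ c U?) c₁≡c₂ ⟩
        armCountAt H₁ (corner H₂) U? ≡⟨ armCountAt-≗ (corner H₂) U? ⟩
        armCountAt H₂ (corner H₂) U? ≡⟨ armLength H₂ ⟩
        suc r₂                       ∎
    by-corners (tri> _ _ c₂≺c₁) = <-asym (s≤s r₂<r₁) (begin-strict
      suc r₁                       ≡⟨ armLength H₁ ⟨
      armCountAt H₁ (corner H₁) U? <⟨ armCount-< U? c₂≺c₁ armExponent₁-c₂ (legExponent-corner H₁)
                                                   (armExponent>0⇒legExponent≡0 H₁) tt ⟩
      armCountAt H₁ (corner H₂) U? ≡⟨ armCountAt-≗ (corner H₂) U? ⟩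
      armCountAt H₂ (corner H₂) U? ≡⟨ armLength H₂ ⟩
      suc r₂                       ∎)
      where
      armExponent₁-c₂ : armExponent H₁ (corner H₂) ≡ 0
      armExponent₁-c₂ = trans (armExp≗ (corner H₂)) (armExponent-corner H₂)
    by-corners (tri< c₁≺c₂ _ _) = <-irrefl refl (begin-strict
      armCountAt H₁ (corner H₂) (t ≺?_) <⟨ armCount-< (t ≺?_) c₁≺c₂ (armExponent-corner H₁) legExponent₁-c₂
                                                        (armExponent>0⇒legExponent≡0 H₁) end≺corner ⟩
      armCountAt H₁ (corner H₁) (t ≺?_) ≡⟨ armExponent-armEnd H₁ ⟨
      armExponent H₁ t                  ≡⟨ armExp≗ t ⟩
      armExponent H₂ t                  ≤⟨ armExponent-≤-armCount H₂ t ⟩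
      armCountAt H₂ (corner H₂) (t ≺?_) ≡⟨ armCountAt-≗ (corner H₂) (t ≺?_) ⟨
      armCountAt H₁ (corner H₂) (t ≺?_) ∎)
      where
      legExponent₁-c₂ : legExponent H₁ (corner H₂) ≡ 0
      legExponent₁-c₂ = trans (legExp≗ (corner H₂)) (legExponent-corner H₂)

module Rows {n} = OrderedHooks (<-isStrictTotalOrder {n}) _<?_
module Columns {n} = OrderedHooks (Flip.isStrictTotalOrder (<-isStrictTotalOrder {n})) (flip _<?_)

tabulate-injective : ∀ {a m} {A : Set a} {f g : Fin m → A} → tabulate f ≡ tabulate g → f ≗ g
tabulate-injective {f = f} {g} eq i = trans (sym (lookup∘tabulate f i)) (trans (cong (λ v → lookup v i) eq) (lookup∘tabulate g i))

yExp≗armExponent : ∀ {n r h} (S : SF n r h) → yExp S ≗ Rows.armExponent (fillingHook S)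
yExp≗armExponent {r = r} S k =
  sumList-allFin² (suc r) (λ j j' → 𝟙 (⌊ j <? j' ⌋ ∧ ⌊ rowEntry S j' <? rowEntry S j ⌋ ∧ ⌊ rowEntry S j' ≟ k ⌋))

xExp≗legExponent : ∀ {n r h} (S : SF n r h) → xExp S ≗ Rows.legExponent (fillingHook S)
xExp≗legExponent {h = h} S k =
  sumList-allFin² (suc h) (λ i i' → 𝟙 (⌊ i <? i' ⌋ ∧ ⌊ colEntry S i <? colEntry S i' ⌋ ∧ ⌊ colEntry S i' ≟ k ⌋))

φ-≡⇒exponents-≗ : ∀ {n r₁ h₁ r₂ h₂} (S : SF n r₁ h₁) (T : SF n r₂ h₂) → φ S ≡ φ T →
  Rows.armExponent (fillingHook S) ≗ Rows.armExponent (fillingHook T) × Rows.legExponent (fillingHook S) ≗ Rows.legExponent (fillingHook T)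
φ-≡⇒exponents-≗ S T φS≡φT =
    (λ k → trans (sym (yExp≗armExponent S k)) (trans (tabulate-injective (cong proj₂ φS≡φT) k) (yExp≗armExponent T k)))
  , (λ k → trans (sym (xExp≗legExponent S k)) (trans (tabulate-injective (cong proj₁ φS≡φT) k) (xExp≗legExponent T k)))

rows-distinct : ∀ {n r₁ h₁ r₂ h₂} (S : SF n r₁ h₁) (T : SF n r₂ h₂) →
  r₂ <ℕ r₁ → rowEntry S (fromℕ r₁) < rowEntry S zero → φ S ≢ φ T
rows-distinct S T r₂<r₁ end<corner φS≡φT =
  Rows.different-exponents (fillingHook S) (fillingHook T) r₂<r₁ end<corner
    (proj₁ (φ-≡⇒exponents-≗ S T φS≡φT)) (proj₂ (φ-≡⇒exponents-≗ S T φS≡φT))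

columns-distinct : ∀ {n r₁ h₁ r₂ h₂} (S : SF n r₁ h₁) (T : SF n r₂ h₂) →
  h₂ <ℕ h₁ → colEntry S zero < colEntry S (fromℕ h₁) → φ S ≢ φ T
columns-distinct S T h₂<h₁ corner<end φS≡φT =
  Columns.different-exponents (transpose (fillingHook S)) (transpose (fillingHook T)) h₂<h₁ corner<end
    (proj₂ (φ-≡⇒exponents-≗ S T φS≡φT)) (proj₁ (φ-≡⇒exponents-≗ S T φS≡φT))

mainTheorem5 : (a' l' : ℕ) →
    ((S : SF (suc (suc a') + l') (suc a') l') → (T : SF (suc (suc a') + l') a' (suc l')) →
      rowEntry S (fromℕ (suc a')) < rowEntry S zero → φ S ≢ φ T)
    × ((T : SF (suc (suc a') + l') a' (suc l')) → (S : SF (suc (suc a') + l') (suc a') l') →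
      colEntry T zero < colEntry T (fromℕ (suc l')) → φ T ≢ φ S)
mainTheorem5 a' l' = (λ S T → rows-distinct S T (n<1+n a')) , (λ T S → columns-distinct T S (n<1+n l'))
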